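{- Let $G$ be a graph, let $S\subseteq V(G)$, and let $k\geq\chi(G)$ be an integer. Put $s=\left\lfloor \frac{|S|}{k}\right\rfloor$ and $r=|S|-sk$. Then $$m(G,\overline{G}[S],k)\geq (k-r)\binom{s}{2}+r\binom{s+1}{2}.$$ Moreover, equality holds if and only if $S$ admits an equitable $k$-coloring.
   Context: All graphs are finite, simple and unweighted. $\overline{G}$ is the complement of $G$, $\overline{G}[S]$ is the subgraph of $\overline{G}$ induced by $S$, and $\chi(G)$ is the chromatic number. A $k$-coloring of $G$ is a map $\phi:V(G)\to\{1,\dots,k\}$ with $\phi(u)\neq\phi(v)$ for every edge $uv$ of $G$. For a subgraph $H$ of $\overline{G}$, an edge $uv$ of $H$ is monochromatic under $\phi$ if $\phi(u)=\phi(v)$. For $k\geq\chi(G)$, $m(G,H,k)$ is the minimum, over all $k$-colorings $\phi$ of $G$, of the number of monochromatic edges of $H$. A $k$-coloring $\phi$ of $G$ is equitable over $S$ if the numbers $n_i=|\phi^{ -1}(i)\cap S|$, $1\le i\le k$, satisfy $|n_i-n_j|\leq 1$ for all $i,j$; $S$ admits an equitable $k$-coloring if some $k$-coloring of $G$ is equitable over $S$. -}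

module Defs where

open import Data.Nat using (ℕ; zero; suc; _+_; _≤_)
open import Data.Bool using (Bool; true; false; _∧_; not; if_then_else_)
open import Data.Fin using (Fin; _<?_; _≟_)
open import Data.Fin.Subset using (Subset)
open import Data.Vec using (lookup)
open import Data.List using (List; map; allFin)
open import Data.Nat.ListAction using (sum)
open import Data.Product using (Σ; ∃; _×_)
open import Relation.Binary.PropositionalEquality using (_≡_; _≢_)
open import Relation.Nullary.Decidable using (⌊_⌋)

record Graph (n : ℕ) : Set where
  field
    adj    : Fin n → Fin n → Bool
    sym    : ∀ u v → adj u v ≡ adj v u
    irrefl : ∀ u → adj u u ≡ false
open Graph public

IsColoring : ∀ {n} (G : Graph n) (k : ℕ) → (Fin n → Fin k) → Set
IsColoring G k φ = ∀ u v → adj G u v ≡ true → φ u ≢ φ v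

ChromaticAtMost : ∀ {n} → Graph n → ℕ → Set
ChromaticAtMost G k = ∃ λ (φ : Fin _ → Fin k) → IsColoring G k φ

[_] : Bool → ℕ
[ b ] = if b then 1 else 0

-- Number of monochromatic edges of the complement of G induced on S:
-- unordered pairs {u,v} (counted once via u < v) with u, v ∈ S,
-- uv not an edge of G, and φ u = φ v.
monoEdges : ∀ {n k} (G : Graph n) (S : Subset n) (φ : Fin n → Fin k) → ℕ
monoEdges {n} G S φ =
  sum (map (λ u → sum (map (λ v →
        [ ⌊ u <? v ⌋ ∧ lookup S u ∧ lookup S v ∧ not (adj G u v)
          ∧ ⌊ φ u ≟ φ v ⌋ ]) (allFin n))) (allFin n))

-- m(G, Ḡ[S], k) = m : m is the minimum number of monochromatic edges of
-- Ḡ[S] over all k-colourings of G (attained, and a lower bound).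
IsMinMono : ∀ {n} (G : Graph n) (S : Subset n) (k : ℕ) (m : ℕ) → Set
IsMinMono {n} G S k m =
  (∃ λ (φ : Fin n → Fin k) → IsColoring G k φ × monoEdges G S φ ≡ m)
  × (∀ (φ : Fin n → Fin k) → IsColoring G k φ → m ≤ monoEdges G S φ)

classSize : ∀ {n k} (S : Subset n) (φ : Fin n → Fin k) (i : Fin k) → ℕ
classSize {n} S φ i = sum (map (λ v → [ lookup S v ∧ ⌊ φ v ≟ i ⌋ ]) (allFin n))

EquitableOver : ∀ {n k} (S : Subset n) (φ : Fin n → Fin k) → Set
EquitableOver S φ = ∀ i j → classSize S φ i ≤ suc (classSize S φ j)

AdmitsEquitable : ∀ {n} (G : Graph n) (S : Subset n) (k : ℕ) → Set
AdmitsEquitable {n} G S k =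
  ∃ λ (φ : Fin n → Fin k) → IsColoring G k φ × EquitableOver S φ

-- Count the ordered pairs of vertices of S with equal colours in two ways.
-- Grouped by colour they number Σᵢ nᵢ². By symmetry they are the |S| diagonal
-- pairs plus twice the pairs u < v, and since a proper colouring gives equal
-- colours only to non-adjacent vertices, these are the monochromatic edges of
-- Ḡ[S]. With s = ⌊|S|/k⌋ one has nᵢ² + s(s+1) = (2s+1)nᵢ + dᵢ(dᵢ+1), where dᵢ
-- is the distance from nᵢ to {s, s+1}; summing over i (Σᵢ nᵢ = |S|) gives
-- 2·mono = 2·bound + Σᵢ dᵢ(dᵢ+1). Hence the bound, with equality exactly when
-- every nᵢ lies in {s, s+1}, which for sizes summing to sk + r with r < k is the
-- same as being equitable.
module Submission where

open import Defs hiding (sym)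
open import Data.Nat using (ℕ; zero; suc; _+_; _*_; _∸_; _≤_; _<_; _/_; _%_; NonZero; z≤n; s≤s)
open import Data.Nat.Properties
  using ( +-*-semiring; +-comm; +-assoc; *-comm; *-assoc; *-zeroʳ; *-identityˡ; *-identityʳ
        ; +-identityʳ; +-cancelʳ-≡; *-cancelˡ-≡; *-cancelˡ-≤; m+n≡0⇒m≡0; m+n≡0⇒n≡0
        ; m∸n≡0⇒m≤n; m≤n⇒m∸n≡0; m+n∸n≡m; m∸n+n≡m; n≤0⇒n≡0; m≤m+n; m≤n+m
        ; ≤-trans; ≤-reflexive; ≤-antisym; ≤-pred; <⇒≱; ≮⇒≥
        ; +-mono-≤; +-mono-<-≤; +-mono-≤-<; +-monoʳ-<; <⇒≤; +-cancelˡ-≡; m*n≡0⇒m≡0 )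
open import Data.Nat.DivMod using (m≡m%n+[m/n]*n; m%n≡m∸m/n*n; m%n<n)
open import Data.Nat.Combinatorics using (_C_; nC1≡n; nCk+nC[k+1]≡[n+1]C[k+1])
open import Data.Nat.ListAction using (sum)
open import Data.Nat.Tactic.RingSolver using (solve-∀)
open import Data.Bool using (true; false; _∧_; not)
open import Data.Fin using (Fin; zero; suc; _<?_; _≟_)
open import Data.Fin.Properties using (<-cmp)
open import Data.Fin.Subset using (Subset; ∣_∣)
open import Data.Vec using ([]; _∷_; lookup)
open import Data.List using (map; allFin; tabulate)
open import Data.Product using (_×_; _,_; proj₁; proj₂)
open import Function.Base using (_∘_; id)
open import Function.Bundles using (_⇔_; mk⇔)
open import Relation.Binary.Definitions using (tri<; tri≈; tri>)
open import Relation.Binary.PropositionalEquality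
  using (_≡_; refl; sym; trans; cong; cong₂; subst; module ≡-Reasoning)
open import Relation.Nullary using (Dec; yes; no; ¬_)
open import Relation.Nullary.Decidable using (⌊_⌋; ⌊⌋-map′; isYes≗does; dec-true; dec-false)
open import Algebra.Properties.Semiring.Sum +-*-semiring
  using (sum-syntax; ∑-distrib-+; ∑-comm; *-distribˡ-sum; *-distribʳ-sum)
  renaming (sum to ∑; sum-cong-≗ to ∑-cong)

open ≡-Reasoning

sum-map-tabulate : ∀ {A : Set} {n} (f : A → ℕ) (g : Fin n → A) →
                   sum (map f (tabulate g)) ≡ ∑[ i < n ] f (g i)
sum-map-tabulate {n = zero}  f g = refl
sum-map-tabulate {n = suc n} f g = cong (f (g zero) +_) (sum-map-tabulate f (g ∘ suc))

sum-map-allFin : ∀ {n} (f : Fin n → ℕ) → sum (map f (allFin n)) ≡ ∑[ i < n ] f i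
sum-map-allFin f = sum-map-tabulate f id

∑-const : ∀ n c → ∑[ i < n ] c ≡ n * c
∑-const zero    c = refl
∑-const (suc n) c = cong (c +_) (∑-const n c)

∑-mono-≤ : ∀ {n} {f g : Fin n → ℕ} → (∀ i → f i ≤ g i) → ∑ f ≤ ∑ g
∑-mono-≤ {zero}  f≤g = z≤n
∑-mono-≤ {suc n} f≤g = +-mono-≤ (f≤g zero) (∑-mono-≤ (f≤g ∘ suc))

∑-mono-< : ∀ {n} {f g : Fin n → ℕ} → (∀ i → f i ≤ g i) → ∀ i → f i < g i → ∑ f < ∑ g
∑-mono-< f≤g zero    fi<gi = +-mono-<-≤ fi<gi (∑-mono-≤ (f≤g ∘ suc))
∑-mono-< f≤g (suc i) fi<gi = +-mono-≤-< (f≤g zero) (∑-mono-< (f≤g ∘ suc) i fi<gi)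

term≤∑ : ∀ {n} (f : Fin n → ℕ) i → f i ≤ ∑ f
term≤∑ f zero    = m≤m+n (f zero) _
term≤∑ f (suc i) = ≤-trans (term≤∑ (f ∘ suc) i) (m≤n+m _ (f zero))

∑≡0⇒≡0 : ∀ {n} (f : Fin n → ℕ) → ∑ f ≡ 0 → ∀ i → f i ≡ 0
∑≡0⇒≡0 f ∑f≡0 i = n≤0⇒n≡0 (subst (f i ≤_) ∑f≡0 (term≤∑ f i))

∑∑-distrib-+ : ∀ {m n} (f g : Fin m → Fin n → ℕ) →
               ∑[ u < m ] ∑[ v < n ] (f u v + g u v)
                 ≡ ∑[ u < m ] ∑[ v < n ] f u v + ∑[ u < m ] ∑[ v < n ] g u v
∑∑-distrib-+ f g =
  trans (∑-cong (λ u → ∑-distrib-+ (f u) (g u))) (∑-distrib-+ (λ u → ∑ (f u)) (λ u → ∑ (g u)))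

∑∑-product : ∀ {m n} (f : Fin m → ℕ) (g : Fin n → ℕ) →
             ∑[ u < m ] ∑[ v < n ] (f u * g v) ≡ ∑ f * ∑ g
∑∑-product {m} {n} f g = begin
  ∑[ u < m ] ∑[ v < n ] (f u * g v)   ≡⟨ ∑-cong (λ u → *-distribˡ-sum (f u) g) ⟨
  ∑[ u < m ] (f u * ∑ g)              ≡⟨ *-distribʳ-sum (∑ g) f ⟨
  ∑ f * ∑ g                           ∎

⌊⌋-true : ∀ {A : Set} (a? : Dec A) → A → ⌊ a? ⌋ ≡ true
⌊⌋-true a? a = trans (isYes≗does a?) (dec-true a? a)

⌊⌋-false : ∀ {A : Set} (a? : Dec A) → ¬ A → ⌊ a? ⌋ ≡ false
⌊⌋-false a? ¬a = trans (isYes≗does a?) (dec-false a? ¬a)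

[∧]≡* : ∀ a b → [ a ∧ b ] ≡ [ a ] * [ b ]
[∧]≡* false b     = refl
[∧]≡* true  false = refl
[∧]≡* true  true  = refl

[b]*[b]≡[b] : ∀ b → [ b ] * [ b ] ≡ [ b ]
[b]*[b]≡[b] false = refl
[b]*[b]≡[b] true  = refl

[≟]-sym : ∀ {k} (a b : Fin k) → [ ⌊ a ≟ b ⌋ ] ≡ [ ⌊ b ≟ a ⌋ ]
[≟]-sym a b with a ≟ b
... | yes refl = cong [_] (sym (⌊⌋-true (a ≟ a) refl))
... | no  a≢b  = cong [_] (sym (⌊⌋-false (b ≟ a) (a≢b ∘ sym)))

∑-select : ∀ {k} (j : Fin k) (g : Fin k → ℕ) → ∑[ i < k ] ([ ⌊ j ≟ i ⌋ ] * g i) ≡ g j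
∑-select {suc k} zero g = begin
  g zero + 0 + ∑[ i < k ] 0   ≡⟨ cong (g zero + 0 +_) (trans (∑-const k 0) (*-zeroʳ k)) ⟩
  g zero + 0 + 0              ≡⟨ trans (+-identityʳ _) (+-identityʳ _) ⟩
  g zero                      ∎
∑-select {suc k} (suc j) g =
  trans (∑-cong (λ i → cong (λ b → [ b ] * g (suc i)) (⌊⌋-map′ _ _ (j ≟ i))))
        (∑-select j (g ∘ suc))

∣S∣≡∑ : ∀ {n} (S : Subset n) → ∣ S ∣ ≡ ∑[ u < n ] [ lookup S u ]
∣S∣≡∑ []          = refl
∣S∣≡∑ (true  ∷ S) = cong suc (∣S∣≡∑ S)
∣S∣≡∑ (false ∷ S) = ∣S∣≡∑ S

-- Double sums over pairs

[<]+[>]+[≡]≡1 : ∀ {n} (u v : Fin n) → [ ⌊ u <? v ⌋ ] + [ ⌊ v <? u ⌋ ] + [ ⌊ u ≟ v ⌋ ] ≡ 1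
[<]+[>]+[≡]≡1 u v with <-cmp u v
... | tri< u<v u≢v u≯v
  rewrite ⌊⌋-true (u <? v) u<v | ⌊⌋-false (v <? u) u≯v | ⌊⌋-false (u ≟ v) u≢v = refl
... | tri≈ u≮v u≡v u≯v
  rewrite ⌊⌋-false (u <? v) u≮v | ⌊⌋-false (v <? u) u≯v | ⌊⌋-true (u ≟ v) u≡v = refl
... | tri> u≮v u≢v u>v
  rewrite ⌊⌋-false (u <? v) u≮v | ⌊⌋-true (v <? u) u>v | ⌊⌋-false (u ≟ v) u≢v = refl

∑∑-symmetric : ∀ {n} (f : Fin n → Fin n → ℕ) → (∀ u v → f u v ≡ f v u) →
               ∑[ u < n ] ∑[ v < n ] f u v
                 ≡ 2 * ∑[ u < n ] ∑[ v < n ] ([ ⌊ u <? v ⌋ ] * f u v) + ∑[ u < n ] f u u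
∑∑-symmetric {n} f f-sym = begin
  ∑[ u < n ] ∑[ v < n ] f u v
    ≡⟨ ∑-cong (λ u → ∑-cong (λ v → split u v)) ⟩
  ∑[ u < n ] ∑[ v < n ] (above u v + below u v + diagonal u v)
    ≡⟨ ∑∑-distrib-+ _ diagonal ⟩
  ∑[ u < n ] ∑[ v < n ] (above u v + below u v) + ∑[ u < n ] ∑[ v < n ] diagonal u v
    ≡⟨ cong₂ _+_ (∑∑-distrib-+ above below) (∑-cong (λ u → ∑-select u (f u))) ⟩
  P + ∑[ u < n ] ∑[ v < n ] below u v + ∑[ u < n ] f u u
    ≡⟨ cong (λ Q → P + Q + ∑[ u < n ] f u u) below≡above ⟩
  P + P + ∑[ u < n ] f u u
    ≡⟨ cong (λ Q → P + Q + ∑[ u < n ] f u u) (sym (+-identityʳ P)) ⟩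
  2 * P + ∑[ u < n ] f u u
    ∎
  where
  above below diagonal : Fin n → Fin n → ℕ
  above    u v = [ ⌊ u <? v ⌋ ] * f u v
  below    u v = [ ⌊ v <? u ⌋ ] * f u v
  diagonal u v = [ ⌊ u ≟ v ⌋ ] * f u v

  P : ℕ
  P = ∑[ u < n ] ∑[ v < n ] above u v

  *-distribʳ-+₃ : ∀ a b c x → (a + b + c) * x ≡ a * x + b * x + c * x
  *-distribʳ-+₃ = solve-∀

  split : ∀ u v → f u v ≡ above u v + below u v + diagonal u v
  split u v = begin
    f u v
      ≡⟨ *-identityˡ (f u v) ⟨
    1 * f u v
      ≡⟨ cong (_* f u v) ([<]+[>]+[≡]≡1 u v) ⟨
    ([ ⌊ u <? v ⌋ ] + [ ⌊ v <? u ⌋ ] + [ ⌊ u ≟ v ⌋ ]) * f u v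
      ≡⟨ *-distribʳ-+₃ [ ⌊ u <? v ⌋ ] [ ⌊ v <? u ⌋ ] [ ⌊ u ≟ v ⌋ ] (f u v) ⟩
    above u v + below u v + diagonal u v
      ∎

  below≡above : ∑[ u < n ] ∑[ v < n ] below u v ≡ P
  below≡above = trans (∑-comm below)
    (∑-cong (λ v → ∑-cong (λ u → cong ([ ⌊ v <? u ⌋ ] *_) (f-sym u v))))

classWeight : ∀ {n k} → (Fin n → Fin k) → (Fin n → ℕ) → Fin k → ℕ
classWeight {n} φ w i = ∑[ u < n ] (w u * [ ⌊ φ u ≟ i ⌋ ])

∑-classWeight : ∀ {n k} (φ : Fin n → Fin k) (w : Fin n → ℕ) →
                ∑[ i < k ] classWeight φ w i ≡ ∑ w
∑-classWeight {n} {k} φ w = trans (∑-comm (λ i u → w u * [ ⌊ φ u ≟ i ⌋ ])) (∑-cong weight)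
  where
  weight : ∀ u → ∑[ i < k ] (w u * [ ⌊ φ u ≟ i ⌋ ]) ≡ w u
  weight u = trans (∑-cong (λ i → *-comm (w u) [ ⌊ φ u ≟ i ⌋ ])) (∑-select (φ u) (λ _ → w u))

∑∑-sameClass≡∑-square : ∀ {n k} (φ : Fin n → Fin k) (w : Fin n → ℕ) →
  ∑[ u < n ] ∑[ v < n ] (w u * w v * [ ⌊ φ u ≟ φ v ⌋ ])
    ≡ ∑[ i < k ] (classWeight φ w i * classWeight φ w i)
∑∑-sameClass≡∑-square {n} {k} φ w = begin
  ∑[ u < n ] ∑[ v < n ] (w u * w v * [ ⌊ φ u ≟ φ v ⌋ ])
    ≡⟨ ∑-cong (λ u → ∑-cong (λ v → byColour u v)) ⟩
  ∑[ u < n ] ∑[ v < n ] ∑[ i < k ] (a u i * a v i)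
    ≡⟨ ∑-cong (λ u → ∑-comm (λ v i → a u i * a v i)) ⟩
  ∑[ u < n ] ∑[ i < k ] ∑[ v < n ] (a u i * a v i)
    ≡⟨ ∑-comm (λ u i → ∑[ v < n ] (a u i * a v i)) ⟩
  ∑[ i < k ] ∑[ u < n ] ∑[ v < n ] (a u i * a v i)
    ≡⟨ ∑-cong (λ i → ∑∑-product (λ u → a u i) (λ v → a v i)) ⟩
  ∑[ i < k ] (classWeight φ w i * classWeight φ w i)
    ∎
  where
  a : Fin n → Fin k → ℕ
  a u i = w u * [ ⌊ φ u ≟ i ⌋ ]

  regroup : ∀ p q x y → p * q * (x * y) ≡ p * x * (q * y)
  regroup = solve-∀

  byColour : ∀ u v → w u * w v * [ ⌊ φ u ≟ φ v ⌋ ] ≡ ∑[ i < k ] (a u i * a v i)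
  byColour u v = begin
    w u * w v * [ ⌊ φ u ≟ φ v ⌋ ]
      ≡⟨ cong (w u * w v *_) (∑-select (φ v) (λ i → [ ⌊ φ u ≟ i ⌋ ])) ⟨
    w u * w v * ∑[ i < k ] ([ ⌊ φ v ≟ i ⌋ ] * [ ⌊ φ u ≟ i ⌋ ])
      ≡⟨ *-distribˡ-sum (w u * w v) (λ i → [ ⌊ φ v ≟ i ⌋ ] * [ ⌊ φ u ≟ i ⌋ ]) ⟩
    ∑[ i < k ] (w u * w v * ([ ⌊ φ v ≟ i ⌋ ] * [ ⌊ φ u ≟ i ⌋ ]))
      ≡⟨ ∑-cong (λ i → trans (cong (w u * w v *_) (*-comm [ ⌊ φ v ≟ i ⌋ ] [ ⌊ φ u ≟ i ⌋ ]))
                             (regroup (w u) (w v) _ _)) ⟩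
    ∑[ i < k ] (a u i * a v i)
      ∎

-- Class sizes of a proper colouring

nonAdjacent∧sameColour : ∀ {n k} (G : Graph n) {φ : Fin n → Fin k} → IsColoring G k φ →
  ∀ u v → not (adj G u v) ∧ ⌊ φ u ≟ φ v ⌋ ≡ ⌊ φ u ≟ φ v ⌋
nonAdjacent∧sameColour G {φ} proper u v with adj G u v in uv
... | false = refl
... | true  = sym (⌊⌋-false (φ u ≟ φ v) (proper u v uv))

inS : ∀ {n} → Subset n → Fin n → ℕ
inS S u = [ lookup S u ]

sameClassInS : ∀ {n k} → Subset n → (Fin n → Fin k) → Fin n → Fin n → ℕ
sameClassInS S φ u v = inS S u * inS S v * [ ⌊ φ u ≟ φ v ⌋ ]

monoEdges≡∑∑ : ∀ {n k} (G : Graph n) (S : Subset n) {φ : Fin n → Fin k} → IsColoring G k φ →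
  monoEdges G S φ ≡ ∑[ u < n ] ∑[ v < n ] ([ ⌊ u <? v ⌋ ] * sameClassInS S φ u v)
monoEdges≡∑∑ {n} G S {φ} proper =
  trans (sum-map-allFin {n} _) (∑-cong λ u → trans (sum-map-allFin {n} _) (∑-cong (summand u)))
  where
  summand : ∀ u v → [ ⌊ u <? v ⌋ ∧ lookup S u ∧ lookup S v ∧ not (adj G u v) ∧ ⌊ φ u ≟ φ v ⌋ ]
                    ≡ [ ⌊ u <? v ⌋ ] * sameClassInS S φ u v
  summand u v = begin
    [ ⌊ u <? v ⌋ ∧ lookup S u ∧ lookup S v ∧ not (adj G u v) ∧ ⌊ φ u ≟ φ v ⌋ ]
      ≡⟨ cong (λ b → [ ⌊ u <? v ⌋ ∧ lookup S u ∧ lookup S v ∧ b ])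
              (nonAdjacent∧sameColour G proper u v) ⟩
    [ ⌊ u <? v ⌋ ∧ lookup S u ∧ lookup S v ∧ ⌊ φ u ≟ φ v ⌋ ]
      ≡⟨ [∧]≡* ⌊ u <? v ⌋ _ ⟩
    [ ⌊ u <? v ⌋ ] * [ lookup S u ∧ lookup S v ∧ ⌊ φ u ≟ φ v ⌋ ]
      ≡⟨ cong ([ ⌊ u <? v ⌋ ] *_) (trans ([∧]≡* (lookup S u) _)
                                          (cong (inS S u *_) ([∧]≡* (lookup S v) _))) ⟩
    [ ⌊ u <? v ⌋ ] * (inS S u * (inS S v * [ ⌊ φ u ≟ φ v ⌋ ]))
      ≡⟨ cong ([ ⌊ u <? v ⌋ ] *_) (*-assoc (inS S u) _ _) ⟨
    [ ⌊ u <? v ⌋ ] * sameClassInS S φ u v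
      ∎

classSize≡classWeight : ∀ {n k} (S : Subset n) (φ : Fin n → Fin k) →
                        ∀ i → classSize S φ i ≡ classWeight φ (inS S) i
classSize≡classWeight {n} S φ i = trans (sum-map-allFin {n} _) (∑-cong (λ v → [∧]≡* (lookup S v) _))

∑-classSize : ∀ {n k} (S : Subset n) (φ : Fin n → Fin k) → ∑ (classSize S φ) ≡ ∣ S ∣
∑-classSize S φ = begin
  ∑ (classSize S φ)            ≡⟨ ∑-cong (classSize≡classWeight S φ) ⟩
  ∑ (classWeight φ (inS S))    ≡⟨ ∑-classWeight φ (inS S) ⟩
  ∑ (inS S)                    ≡⟨ ∣S∣≡∑ S ⟨
  ∣ S ∣                        ∎

2*monoEdges+∣S∣≡∑-classSize² : ∀ {n k} (G : Graph n) (S : Subset n) {φ : Fin n → Fin k} →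
  IsColoring G k φ →
  2 * monoEdges G S φ + ∣ S ∣ ≡ ∑[ i < k ] (classSize S φ i * classSize S φ i)
2*monoEdges+∣S∣≡∑-classSize² {n} {k} G S {φ} proper = begin
  2 * monoEdges G S φ + ∣ S ∣
    ≡⟨ cong₂ (λ M N → 2 * M + N) (monoEdges≡∑∑ G S proper) (trans (∣S∣≡∑ S) (∑-cong diagonal)) ⟩
  2 * ∑[ u < n ] ∑[ v < n ] ([ ⌊ u <? v ⌋ ] * pair u v) + ∑[ u < n ] pair u u
    ≡⟨ ∑∑-symmetric pair pair-sym ⟨
  ∑[ u < n ] ∑[ v < n ] pair u v
    ≡⟨ ∑∑-sameClass≡∑-square φ (inS S) ⟩
  ∑[ i < k ] (classWeight φ (inS S) i * classWeight φ (inS S) i)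
    ≡⟨ ∑-cong (λ i → cong₂ _*_ (classSize≡classWeight S φ i) (classSize≡classWeight S φ i)) ⟨
  ∑[ i < k ] (classSize S φ i * classSize S φ i)
    ∎
  where
  pair : Fin n → Fin n → ℕ
  pair = sameClassInS S φ

  pair-sym : ∀ u v → pair u v ≡ pair v u
  pair-sym u v = cong₂ _*_ (*-comm (inS S u) (inS S v)) ([≟]-sym (φ u) (φ v))

  diagonal : ∀ u → inS S u ≡ pair u u
  diagonal u = begin
    inS S u                              ≡⟨ [b]*[b]≡[b] (lookup S u) ⟨
    inS S u * inS S u                    ≡⟨ *-identityʳ _ ⟨
    inS S u * inS S u * 1                ≡⟨ cong (λ b → inS S u * inS S u * [ b ]) (⌊⌋-true (φ u ≟ φ u) refl) ⟨
    pair u u                             ∎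

-- Arithmetic of the bound

[1+n]C2≡n+nC2 : ∀ n → suc n C 2 ≡ n + n C 2
[1+n]C2≡n+nC2 n = trans (sym (nCk+nC[k+1]≡[n+1]C[k+1] n 1)) (cong (_+ n C 2) (nC1≡n n))

2*nC2+n≡n*n : ∀ n → 2 * (n C 2) + n ≡ n * n
2*nC2+n≡n*n zero    = refl
2*nC2+n≡n*n (suc n) = begin
  2 * (suc n C 2) + suc n          ≡⟨ cong (λ c → 2 * c + suc n) ([1+n]C2≡n+nC2 n) ⟩
  2 * (n + n C 2) + suc n          ≡⟨ regroup n (n C 2) ⟩
  2 * (n C 2) + n + 2 * n + 1      ≡⟨ cong (λ m → m + 2 * n + 1) (2*nC2+n≡n*n n) ⟩
  n * n + 2 * n + 1                ≡⟨ square-suc n ⟩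
  suc n * suc n                    ∎
  where
  regroup : ∀ n c → 2 * (n + c) + suc n ≡ 2 * c + n + 2 * n + 1
  regroup = solve-∀
  square-suc : ∀ n → n * n + 2 * n + 1 ≡ suc n * suc n
  square-suc = solve-∀

bound : ℕ → ℕ → ℕ → ℕ
bound k s r = (k ∸ r) * (s C 2) + r * ((s + 1) C 2)

2*bound+N+k*s*[s+1]≡[2s+1]*N : ∀ k s r → r ≤ k →
  2 * bound k s r + (s * k + r) + k * (s * (s + 1)) ≡ (2 * s + 1) * (s * k + r)
2*bound+N+k*s*[s+1]≡[2s+1]*N k s r r≤k = subst Identity (m∸n+n≡m r≤k) (identity (k ∸ r))
  where
  Identity : ℕ → Set
  Identity k = 2 * bound k s r + (s * k + r) + k * (s * (s + 1)) ≡ (2 * s + 1) * (s * k + r)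

  c : ℕ
  c = s C 2

  polynomial : ∀ a r s c →
    2 * (a * c + r * (s + c)) + (s * (a + r) + r) + (a + r) * (s * (s + 1)) + (a + r) * (s * s)
      ≡ (2 * s + 1) * (s * (a + r) + r) + (a + r) * (2 * c + s)
  polynomial = solve-∀

  identity : ∀ a → Identity (a + r)
  identity a = +-cancelʳ-≡ ((a + r) * (s * s)) _ _ (begin
    2 * bound (a + r) s r + (s * (a + r) + r) + (a + r) * (s * (s + 1)) + (a + r) * (s * s)
      ≡⟨ cong (λ b → 2 * b + (s * (a + r) + r) + (a + r) * (s * (s + 1)) + (a + r) * (s * s))
              (cong₂ (λ x y → x * c + r * y) (m+n∸n≡m a r)
                     (trans (cong (_C 2) (+-comm s 1)) ([1+n]C2≡n+nC2 s))) ⟩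
    2 * (a * c + r * (s + c)) + (s * (a + r) + r) + (a + r) * (s * (s + 1)) + (a + r) * (s * s)
      ≡⟨ polynomial a r s c ⟩
    (2 * s + 1) * (s * (a + r) + r) + (a + r) * (2 * c + s)
      ≡⟨ cong (λ q → (2 * s + 1) * (s * (a + r) + r) + (a + r) * q) (2*nC2+n≡n*n s) ⟩
    (2 * s + 1) * (s * (a + r) + r) + (a + r) * (s * s)
      ∎)

distToPair : ℕ → ℕ → ℕ
distToPair s x = (s ∸ x) + (x ∸ suc s)

x*x+s*[s+1]≡[2s+1]*x+d*[1+d] : ∀ s x →
  x * x + s * (s + 1) ≡ (2 * s + 1) * x + distToPair s x * suc (distToPair s x)
x*x+s*[s+1]≡[2s+1]*x+d*[1+d] zero    zero    = refl
x*x+s*[s+1]≡[2s+1]*x+d*[1+d] zero    (suc x) = base x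
  where
  base : ∀ x → suc x * suc x + 0 ≡ 1 * suc x + x * suc x
  base = solve-∀
x*x+s*[s+1]≡[2s+1]*x+d*[1+d] (suc s) zero    = base s
  where
  base : ∀ s → 0 * 0 + suc s * (suc s + 1) ≡ (2 * suc s + 1) * 0 + (suc s + 0) * suc (suc s + 0)
  base = solve-∀
x*x+s*[s+1]≡[2s+1]*x+d*[1+d] (suc s) (suc x) = begin
  suc x * suc x + suc s * (suc s + 1)           ≡⟨ lhs s x ⟩
  x * x + s * (s + 1) + 2 * (x + s) + 3         ≡⟨ cong (λ m → m + 2 * (x + s) + 3) (x*x+s*[s+1]≡[2s+1]*x+d*[1+d] s x) ⟩
  (2 * s + 1) * x + d * suc d + 2 * (x + s) + 3 ≡⟨ rhs s x (d * suc d) ⟩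
  (2 * suc s + 1) * suc x + d * suc d           ∎
  where
  d : ℕ
  d = distToPair s x
  lhs : ∀ s x → suc x * suc x + suc s * (suc s + 1) ≡ x * x + s * (s + 1) + 2 * (x + s) + 3
  lhs = solve-∀
  rhs : ∀ s x e → (2 * s + 1) * x + e + 2 * (x + s) + 3 ≡ (2 * suc s + 1) * suc x + e
  rhs = solve-∀

distToPair≡0⇒ : ∀ s x → distToPair s x ≡ 0 → s ≤ x × x ≤ suc s
distToPair≡0⇒ s x d≡0 = m∸n≡0⇒m≤n (m+n≡0⇒m≡0 _ d≡0) , m∸n≡0⇒m≤n (m+n≡0⇒n≡0 _ d≡0)

distToPair≡0⇐ : ∀ s x → s ≤ x × x ≤ suc s → distToPair s x ≡ 0
distToPair≡0⇐ s x (s≤x , x≤1+s) = cong₂ _+_ (m≤n⇒m∸n≡0 s≤x) (m≤n⇒m∸n≡0 x≤1+s)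

equitable⇒nearQuotient : ∀ {k} (x : Fin k → ℕ) s r → ∑ x ≡ s * k + r → r < k →
  (∀ i j → x i ≤ suc (x j)) → ∀ i → s ≤ x i × x i ≤ suc s
equitable⇒nearQuotient {k} x s r ∑x≡ r<k balanced i = atLeast , atMost
  where
  atLeast : s ≤ x i
  atLeast = ≮⇒≥ λ xi<s →
    <⇒≱ (∑-mono-< {g = λ _ → s} (λ j → ≤-trans (balanced j i) xi<s) i xi<s)
        (≤-trans (≤-reflexive (trans (∑-const k s) (*-comm k s)))
                 (≤-trans (m≤m+n (s * k) r) (≤-reflexive (sym ∑x≡))))

  atMost : x i ≤ suc s
  atMost = ≮⇒≥ λ 1+s<xi →
    <⇒≱ (∑-mono-< {f = λ _ → suc s} (λ j → ≤-pred (≤-trans 1+s<xi (balanced i j))) i 1+s<xi)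
        (≤-trans (≤-reflexive ∑x≡)
                 (≤-trans (<⇒≤ (+-monoʳ-< (s * k) r<k))
                          (≤-reflexive (trans (sk+k≡k*[1+s] s k) (sym (∑-const k (suc s)))))))
    where
    sk+k≡k*[1+s] : ∀ s k → s * k + k ≡ k * suc s
    sk+k≡k*[1+s] = solve-∀

nearQuotient⇒equitable : ∀ {k} (x : Fin k → ℕ) s →
  (∀ i → s ≤ x i × x i ≤ suc s) → ∀ i j → x i ≤ suc (x j)
nearQuotient⇒equitable x s near i j = ≤-trans (proj₂ (near i)) (s≤s (proj₁ (near j)))

m≡[m/n]*n+[m∸[m/n]*n] : ∀ m n .{{_ : NonZero n}} → m ≡ (m / n) * n + (m ∸ (m / n) * n)
m≡[m/n]*n+[m∸[m/n]*n] m n =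
  trans (m≡m%n+[m/n]*n m n) (trans (+-comm (m % n) _) (cong ((m / n) * n +_) (m%n≡m∸m/n*n m n)))

m∸[m/n]*n<n : ∀ m n .{{_ : NonZero n}} → m ∸ (m / n) * n < n
m∸[m/n]*n<n m n = subst (_< n) (m%n≡m∸m/n*n m n) (m%n<n m n)

-- The bound for a fixed colouring

module _ {n} (G : Graph n) (S : Subset n) (k : ℕ) .{{_ : NonZero k}} where

  private
    s r : ℕ
    s = ∣ S ∣ / k
    r = ∣ S ∣ ∸ s * k

    excess : (Fin n → Fin k) → Fin k → ℕ
    excess φ i = distToPair s (classSize S φ i) * suc (distToPair s (classSize S φ i))

    2*bound+∣S∣+k*s*[s+1]≡[2s+1]*∣S∣ :
      2 * bound k s r + ∣ S ∣ + k * (s * (s + 1)) ≡ (2 * s + 1) * ∣ S ∣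
    2*bound+∣S∣+k*s*[s+1]≡[2s+1]*∣S∣ =
      subst (λ N → 2 * bound k s r + N + k * (s * (s + 1)) ≡ (2 * s + 1) * N)
            (sym (m≡[m/n]*n+[m∸[m/n]*n] ∣ S ∣ k))
            (2*bound+N+k*s*[s+1]≡[2s+1]*N k s r (<⇒≤ (m∸[m/n]*n<n ∣ S ∣ k)))

  2*monoEdges≡2*bound+∑excess : ∀ {φ} → IsColoring G k φ →
    2 * monoEdges G S φ ≡ 2 * bound k s r + ∑ (excess φ)
  2*monoEdges≡2*bound+∑excess {φ} proper = +-cancelʳ-≡ (∣ S ∣ + K) _ _ (begin
    2 * monoEdges G S φ + (∣ S ∣ + K)
      ≡⟨ +-assoc (2 * monoEdges G S φ) ∣ S ∣ K ⟨
    2 * monoEdges G S φ + ∣ S ∣ + K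
      ≡⟨ cong₂ _+_ (2*monoEdges+∣S∣≡∑-classSize² G S proper) (sym (∑-const k (s * (s + 1)))) ⟩
    ∑[ i < k ] (x i * x i) + ∑[ i < k ] (s * (s + 1))
      ≡⟨ ∑-distrib-+ (λ i → x i * x i) (λ _ → s * (s + 1)) ⟨
    ∑[ i < k ] (x i * x i + s * (s + 1))
      ≡⟨ ∑-cong (λ i → x*x+s*[s+1]≡[2s+1]*x+d*[1+d] s (x i)) ⟩
    ∑[ i < k ] ((2 * s + 1) * x i + excess φ i)
      ≡⟨ ∑-distrib-+ (λ i → (2 * s + 1) * x i) (excess φ) ⟩
    ∑[ i < k ] ((2 * s + 1) * x i) + ∑ (excess φ)
      ≡⟨ cong (_+ ∑ (excess φ))
              (trans (sym (*-distribˡ-sum (2 * s + 1) x)) (cong ((2 * s + 1) *_) (∑-classSize S φ))) ⟩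
    (2 * s + 1) * ∣ S ∣ + ∑ (excess φ)
      ≡⟨ cong (_+ ∑ (excess φ)) 2*bound+∣S∣+k*s*[s+1]≡[2s+1]*∣S∣ ⟨
    2 * bound k s r + ∣ S ∣ + K + ∑ (excess φ)
      ≡⟨ regroup (2 * bound k s r) ∣ S ∣ K (∑ (excess φ)) ⟩
    2 * bound k s r + ∑ (excess φ) + (∣ S ∣ + K)
      ∎)
    where
    x : Fin k → ℕ
    x = classSize S φ

    K : ℕ
    K = k * (s * (s + 1))

    regroup : ∀ b N K e → b + N + K + e ≡ b + e + (N + K)
    regroup = solve-∀

  bound≤monoEdges : ∀ {φ} → IsColoring G k φ → bound k s r ≤ monoEdges G S φ
  bound≤monoEdges proper =
    *-cancelˡ-≤ 2 (subst (2 * bound k s r ≤_) (sym (2*monoEdges≡2*bound+∑excess proper)) (m≤m+n _ _))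

  monoEdges≡bound⇒equitable : ∀ {φ} → IsColoring G k φ →
    monoEdges G S φ ≡ bound k s r → EquitableOver S φ
  monoEdges≡bound⇒equitable {φ} proper mono≡bound =
    nearQuotient⇒equitable (classSize S φ) s λ i →
      distToPair≡0⇒ s (classSize S φ i) (m*n≡0⇒m≡0 _ _ (∑≡0⇒≡0 (excess φ) ∑excess≡0 i))
    where
    ∑excess≡0 : ∑ (excess φ) ≡ 0
    ∑excess≡0 = +-cancelˡ-≡ (2 * bound k s r) _ _ (begin
      2 * bound k s r + ∑ (excess φ)   ≡⟨ 2*monoEdges≡2*bound+∑excess proper ⟨
      2 * monoEdges G S φ              ≡⟨ cong (2 *_) mono≡bound ⟩
      2 * bound k s r                  ≡⟨ +-identityʳ _ ⟨
      2 * bound k s r + 0              ∎)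

  equitable⇒monoEdges≡bound : ∀ {φ} → IsColoring G k φ →
    EquitableOver S φ → monoEdges G S φ ≡ bound k s r
  equitable⇒monoEdges≡bound {φ} proper equitable = *-cancelˡ-≡ _ _ 2 (begin
    2 * monoEdges G S φ              ≡⟨ 2*monoEdges≡2*bound+∑excess proper ⟩
    2 * bound k s r + ∑ (excess φ)   ≡⟨ cong (2 * bound k s r +_) ∑excess≡0 ⟩
    2 * bound k s r + 0              ≡⟨ +-identityʳ _ ⟩
    2 * bound k s r                  ∎)
    where
    near : ∀ i → s ≤ classSize S φ i × classSize S φ i ≤ suc s
    near = equitable⇒nearQuotient (classSize S φ) s r
             (trans (∑-classSize S φ) (m≡[m/n]*n+[m∸[m/n]*n] ∣ S ∣ k))
             (m∸[m/n]*n<n ∣ S ∣ k) equitable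

    ∑excess≡0 : ∑ (excess φ) ≡ 0
    ∑excess≡0 = begin
      ∑ (excess φ)       ≡⟨ ∑-cong (λ i → cong (λ d → d * suc d) (distToPair≡0⇐ s _ (near i))) ⟩
      ∑[ i < k ] 0       ≡⟨ ∑-const k 0 ⟩
      k * 0              ≡⟨ *-zeroʳ k ⟩
      0                  ∎

proposition2 : ∀ {n} (G : Graph n) (S : Subset n) (k : ℕ) .{{_ : NonZero k}}
    → ChromaticAtMost G k
    → ∀ (m : ℕ) → IsMinMono G S k m
    → let s = ∣ S ∣ / k
          r = ∣ S ∣ ∸ s * k
          bound = (k ∸ r) * (s C 2) + r * ((s + 1) C 2)
      in (bound ≤ m) × ((m ≡ bound) ⇔ AdmitsEquitable G S k)
proposition2 G S k _ m ((φ₀ , proper₀ , mono₀≡m) , minimal) =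
  bound≤m , mk⇔ m≡bound⇒equitable equitable⇒m≡bound
  where
  B : ℕ
  B = bound k (∣ S ∣ / k) (∣ S ∣ ∸ (∣ S ∣ / k) * k)

  bound≤m : B ≤ m
  bound≤m = subst (B ≤_) mono₀≡m (bound≤monoEdges G S k proper₀)

  m≡bound⇒equitable : m ≡ B → AdmitsEquitable G S k
  m≡bound⇒equitable m≡B =
    φ₀ , proper₀ , monoEdges≡bound⇒equitable G S k proper₀ (trans mono₀≡m m≡B)

  equitable⇒m≡bound : AdmitsEquitable G S k → m ≡ B
  equitable⇒m≡bound (φ , proper , equitable) =
    ≤-antisym (≤-trans (minimal φ proper)
                       (≤-reflexive (equitable⇒monoEdges≡bound G S k proper equitable)))
              bound≤m
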